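{- Let $p$ be an odd prime, $d$ a positive integer with $p\nmid d$, and $j$ an integer with $(p+1)/2\le j\le p-1$. Then $$\bigcup_{i=j+1}^{p-1} E_{i,j+1}\subset A_{j,j},$$ and the union on the left is a disjoint union.
   Context: For integers $0\le j\le i\le p-1$ set $\tau_{i,j}=id-(1-\frac1p)dj$, $A_{i,j}=\{n\in\mathbb{Z}: p\mid n,\ \tau_{i,j}<n\le id\}$, and $E_{i,j}=\{n\in\mathbb{Z}: p\mid n,\ \tau_{i,j}<n\le \tau_{i,j-1}\}$. -}

module Defs where

open import Data.Nat using (ℕ)
open import Data.Integer using (ℤ; +_; _+_; _-_; _*_; _<_; _≤_)
open import Data.Integer.Divisibility using (_∣_)
open import Data.Product using (_×_)

-- The threshold τ_{i,j} = i d - (1 - 1/p) d j is rational.  We work with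
-- pτ_{i,j} := p · τ_{i,j} = p i d - (p - 1) d j, which is an integer, and
-- express  τ_{i,j} < n  as  pτ_{i,j} < p n  and  n ≤ τ_{i,j}  as  p n ≤ pτ_{i,j}
-- (equivalent since p > 0).  The index j is an integer so that j - 1 makes sense.
pτ : (p d : ℕ) (i j : ℤ) → ℤ
pτ p d i j = (+ p) * i * (+ d) - ((+ p) - + 1) * (+ d) * j

InA : (p d : ℕ) (i j : ℤ) (n : ℤ) → Set
InA p d i j n = ((+ p) ∣ n) × (pτ p d i j < (+ p) * n) × (n ≤ i * (+ d))

InE : (p d : ℕ) (i j : ℤ) (n : ℤ) → Set
InE p d i j n = ((+ p) ∣ n) × (pτ p d i j < (+ p) * n) × ((+ p) * n ≤ pτ p d i (j - + 1))

-- Everything is an inequality between the scaled thresholds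
-- pτ(i,j) = p·τ_{i,j} = p i d - (p-1) d j, and two exact identities do the work:
--   * pτ-step:   pτ(i+1+t, j+1) = pτ(i,j) + (p t + 1) d,
--     so raising both indices pushes the threshold strictly up (when d ≥ 1);
--   * pτ-slack:  pτ(i,j) + c d = p · j d  whenever  p i + j + c = 2 p j,
--     so τ_{i,j} ≤ j d as soon as p i + j ≤ 2 p j (index-bound).
-- Inclusion: the lower bound of E_{i,j+1} sits above τ_{j,j} by pτ-step
-- (with i = j+1+k), and its upper bound τ_{i,j} is at most j d by pτ-slack.
-- Disjointness: for i < i′ the lower bound τ_{i′,j+1} of E_{i′,j+1} exceeds
-- the upper bound τ_{i,j} of E_{i,j+1}, again by pτ-step.
module Submission where

open import Defs
open import Data.Nat using (ℕ; _≤_; _<_; _+_; _*_; suc)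
open import Data.Nat.Primality using (Prime)
open import Data.Nat.Divisibility using (_∣_)
open import Data.Integer using (ℤ; +_)
open import Data.Product using (_×_)
open import Relation.Nullary using (¬_)
open import Relation.Binary.PropositionalEquality using (_≡_)

open import Data.Product using (_,_; ∃)
open import Data.Empty using (⊥; ⊥-elim)
open import Relation.Binary.PropositionalEquality using (refl; sym; cong; subst; module ≡-Reasoning)
open import Relation.Binary.Definitions using (tri<; tri≈; tri>)
import Data.Nat.Properties as ℕP
import Data.Integer as ℤ
import Data.Integer.Properties as ℤP
open import Data.Integer.Tactic.RingSolver using (solve-∀)
open import Data.Nat.Tactic.RingSolver as ℕSolver using ()

<-+-suc : ∀ x c → x ℤ.< x ℤ.+ + suc c
<-+-suc x c = subst (ℤ._< x ℤ.+ + suc c) (ℤP.+-identityʳ x) (ℤP.+-monoʳ-< x (ℤ.+<+ (ℕP.0<1+n {c})))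

<-witness : ∀ {m n} → m + 1 ≤ n → ∃ λ t → suc m + t ≡ n
<-witness {m} {n} m+1≤n = ℕP.m≤n⇒∃[o]m+o≡n (subst (_≤ n) (ℕP.+-comm m 1) m+1≤n)

-- The ℕ-to-ℤ cast of (p t + 1) d, in the form the ring solver produces.
cast-step : ∀ p t d → + (suc (p * t) * d) ≡ (+ p ℤ.* + t ℤ.+ + 1) ℤ.* + d
cast-step p t d = begin
  + (suc (p * t) * d)              ≡⟨ ℤP.pos-* (suc (p * t)) d ⟩
  + suc (p * t) ℤ.* + d            ≡⟨ cong (λ x → + x ℤ.* + d) (ℕP.+-comm 1 (p * t)) ⟩
  (+ (p * t) ℤ.+ + 1) ℤ.* + d      ≡⟨ cong (λ x → (x ℤ.+ + 1) ℤ.* + d) (ℤP.pos-* p t) ⟩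
  (+ p ℤ.* + t ℤ.+ + 1) ℤ.* + d    ∎
  where open ≡-Reasoning

pτ-step : ∀ p d i j t →
  pτ p d (+ (suc i + t)) (+ suc j) ≡ pτ p d (+ i) (+ j) ℤ.+ + (suc (p * t) * d)
pτ-step p d i j t = begin
  pτ p d (+ (suc i + t)) (+ suc j)
    ≡⟨ step-identity (+ p) (+ d) (+ i) (+ j) (+ t) ⟩
  pτ p d (+ i) (+ j) ℤ.+ (+ p ℤ.* + t ℤ.+ + 1) ℤ.* + d
    ≡⟨ cong (λ x → pτ p d (+ i) (+ j) ℤ.+ x) (sym (cast-step p t d)) ⟩
  pτ p d (+ i) (+ j) ℤ.+ + (suc (p * t) * d) ∎
  where
  open ≡-Reasoning
  step-identity : ∀ P D I J T →
    P ℤ.* (+ 1 ℤ.+ I ℤ.+ T) ℤ.* D ℤ.- (P ℤ.- + 1) ℤ.* D ℤ.* (+ 1 ℤ.+ J)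
      ≡ (P ℤ.* I ℤ.* D ℤ.- (P ℤ.- + 1) ℤ.* D ℤ.* J) ℤ.+ (P ℤ.* T ℤ.+ + 1) ℤ.* D
  step-identity = solve-∀

pτ-slack : ∀ p d i j c → p * i + j + c ≡ 2 * (p * j) →
  pτ p d (+ i) (+ j) ℤ.+ + (c * d) ≡ + p ℤ.* (+ j ℤ.* + d)
pτ-slack p d i j c balance = begin
  pτ p d (+ i) (+ j) ℤ.+ + (c * d)
    ≡⟨ cong (λ x → pτ p d (+ i) (+ j) ℤ.+ x) (ℤP.pos-* c d) ⟩
  P ℤ.* I ℤ.* D ℤ.- (P ℤ.- + 1) ℤ.* D ℤ.* J ℤ.+ C ℤ.* D
    ≡⟨ regroup P D I J C ⟩
  (P ℤ.* I ℤ.+ J ℤ.+ C) ℤ.* D ℤ.- P ℤ.* J ℤ.* D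
    ≡⟨ cong (λ x → x ℤ.* D ℤ.- P ℤ.* J ℤ.* D) balanceℤ ⟩
  + 2 ℤ.* (P ℤ.* J) ℤ.* D ℤ.- P ℤ.* J ℤ.* D
    ≡⟨ halve P D J ⟩
  P ℤ.* (J ℤ.* D) ∎
  where
  open ≡-Reasoning
  P = + p; D = + d; I = + i; J = + j; C = + c
  balanceℤ : P ℤ.* I ℤ.+ J ℤ.+ C ≡ + 2 ℤ.* (P ℤ.* J)
  balanceℤ = begin
    P ℤ.* I ℤ.+ J ℤ.+ C          ≡⟨ cong (λ x → x ℤ.+ J ℤ.+ C) (sym (ℤP.pos-* p i)) ⟩
    + (p * i + j + c)            ≡⟨ cong +_ balance ⟩
    + (2 * (p * j))              ≡⟨ ℤP.pos-* 2 (p * j) ⟩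
    + 2 ℤ.* + (p * j)            ≡⟨ cong (+ 2 ℤ.*_) (ℤP.pos-* p j) ⟩
    + 2 ℤ.* (P ℤ.* J)            ∎
  regroup : ∀ P D I J C →
    P ℤ.* I ℤ.* D ℤ.- (P ℤ.- + 1) ℤ.* D ℤ.* J ℤ.+ C ℤ.* D
      ≡ (P ℤ.* I ℤ.+ J ℤ.+ C) ℤ.* D ℤ.- P ℤ.* J ℤ.* D
  regroup = solve-∀
  halve : ∀ P D J → + 2 ℤ.* (P ℤ.* J) ℤ.* D ℤ.- P ℤ.* J ℤ.* D ≡ P ℤ.* (J ℤ.* D)
  halve = solve-∀

index-bound : ∀ {p i j} → j + 1 ≤ i → i + 1 ≤ p → p + 1 ≤ 2 * j → p * i + j ≤ 2 * (p * j)
index-bound {p} {i} {j} j<i i<p p<2j = begin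
  p * i + j        ≤⟨ ℕP.+-monoʳ-≤ (p * i) j≤2p ⟩
  p * i + 2 * p    ≡⟨ factor p i ⟩
  p * (i + 2)      ≤⟨ ℕP.*-monoʳ-≤ p i+2≤2j ⟩
  p * (2 * j)      ≡⟨ swap p j ⟩
  2 * (p * j)      ∎
  where
  open ℕP.≤-Reasoning
  factor : ∀ p i → p * i + 2 * p ≡ p * (i + 2)
  factor = ℕSolver.solve-∀
  swap : ∀ p j → p * (2 * j) ≡ 2 * (p * j)
  swap = ℕSolver.solve-∀
  j≤2p : j ≤ 2 * p
  j≤2p = ℕP.≤-trans (ℕP.m≤m+n j 1) (ℕP.≤-trans j<i
    (ℕP.≤-trans (ℕP.m≤m+n i 1) (ℕP.≤-trans i<p (ℕP.m≤m+n p (p + 0)))))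
  i+2≤2j : i + 2 ≤ 2 * j
  i+2≤2j = subst (_≤ 2 * j) (ℕP.+-assoc i 1 1) (ℕP.≤-trans (ℕP.+-monoˡ-≤ 1 i<p) p<2j)

E⊆A : ∀ {p d i j} (n : ℤ) → j + 1 ≤ i → i + 1 ≤ p → p + 1 ≤ 2 * j
    → InE p d (+ i) (+ suc j) n → InA p d (+ j) (+ j) n
E⊆A {p} {d} {i} {j} n j<i i<p p<2j (p∣n , above , below)
  with <-witness j<i | <-witness i<p | ℕP.m≤n⇒∃[o]m+o≡n (index-bound j<i i<p p<2j)
... | k , refl | m , refl | c , balance = p∣n , above′ , below′
  where
  -- τ_{j,j} ≤ τ_{i,j+1}, since i = j + 1 + k
  above′ : pτ p d (+ j) (+ j) ℤ.< + p ℤ.* n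
  above′ = ℤP.≤-<-trans
    (subst (pτ p d (+ j) (+ j) ℤ.≤_) (sym (pτ-step p d j j k)) (ℤP.i≤i+j _ _))
    above
  below′ : n ℤ.≤ + j ℤ.* + d
  below′ = ℤP.*-cancelˡ-≤-pos n (+ j ℤ.* + d) (+ p) (ℤP.≤-trans below
    (subst (pτ p d (+ i) (+ j) ℤ.≤_) (pτ-slack p d i j c balance) (ℤP.i≤i+j _ _)))

E-disjoint : ∀ {p d j i i′} (n : ℤ) → 1 ≤ d → i < i′
    → InE p d (+ i) (+ suc j) n → InE p d (+ i′) (+ suc j) n → ⊥
E-disjoint {p} {suc d} {j} {i} n _ i<i′ (_ , _ , below) (_ , above , _)
  with ℕP.m≤n⇒∃[o]m+o≡n i<i′
... | t , refl = ℤP.<-irrefl refl (ℤP.<-trans gap (ℤP.<-≤-trans above below))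
  where
  gap : pτ p (suc d) (+ i) (+ j) ℤ.< pτ p (suc d) (+ (suc i + t)) (+ suc j)
  gap = subst (pτ p (suc d) (+ i) (+ j) ℤ.<_) (sym (pτ-step p (suc d) i j t)) (<-+-suc _ _)

lemma2p10 : (p d j : ℕ) → Prime p → ¬ (2 ∣ p) → 1 ≤ d → ¬ (p ∣ d)
    → p + 1 ≤ 2 * j → j + 1 ≤ p
    → ((i : ℕ) (n : ℤ) → j + 1 ≤ i → i + 1 ≤ p
         → InE p d (+ i) (+ (suc j)) n → InA p d (+ j) (+ j) n)
      × ((i i′ : ℕ) (n : ℤ) → j + 1 ≤ i → i + 1 ≤ p → j + 1 ≤ i′ → i′ + 1 ≤ p
         → InE p d (+ i) (+ (suc j)) n → InE p d (+ i′) (+ (suc j)) n → i ≡ i′)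
lemma2p10 p d j _ _ d≥1 _ p<2j _ = inclusion , disjointness
  where
  inclusion : (i : ℕ) (n : ℤ) → j + 1 ≤ i → i + 1 ≤ p
    → InE p d (+ i) (+ (suc j)) n → InA p d (+ j) (+ j) n
  inclusion i n j<i i<p = E⊆A n j<i i<p p<2j
  disjointness : (i i′ : ℕ) (n : ℤ) → j + 1 ≤ i → i + 1 ≤ p → j + 1 ≤ i′ → i′ + 1 ≤ p
    → InE p d (+ i) (+ (suc j)) n → InE p d (+ i′) (+ (suc j)) n → i ≡ i′
  disjointness i i′ n _ _ _ _ n∈E n∈E′ with ℕP.<-cmp i i′
  ... | tri< i<i′ _ _ = ⊥-elim (E-disjoint n d≥1 i<i′ n∈E n∈E′)
  ... | tri≈ _ i≡i′ _ = i≡i′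
  ... | tri> _ _ i′<i = ⊥-elim (E-disjoint n d≥1 i′<i n∈E′ n∈E)
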